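{- An injective morphism $\phi:\Sigma^*\to\Gamma^*$ is strongly interference-free if and only if $\phi$ is interference-free on $\Sigma$ (viewed as the set of one-letter words).
   Context: Images of $\phi$ are $\phi(c)$, $c\in\Sigma$. A word admits an image factorization if it is a concatenation of zero or more images. A word $w$ admits an interfered image factorization if $w=xyz$ with $x$ a proper (possibly empty) suffix of some image, $y$ admitting an image factorization, $z$ a proper (possibly empty) prefix of some image, and $xz\neq\varepsilon$. A word is an inner image factor if it is a proper factor of some image $\phi(c)$ that is neither a prefix nor a suffix of $\phi(c)$. For injective $\phi$, $\phi$ is interference-free on $\mathcal{L}$ if for every non-empty $u\in\mathcal{L}$, $\phi(u)$ admits no interfered image factorization and is not an inner image factor; $\phi$ is strongly interference-free if it is interference-free on $\Sigma^*$. -}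

module Defs where

open import Data.Nat using (ℕ)
open import Data.Unit using (⊤)
open import Data.Fin using (Fin)
open import Data.List using (List; []; _∷_; _++_; concatMap)
open import Data.Product using (Σ; ∃; ∃-syntax; _×_; _,_)
open import Relation.Binary.PropositionalEquality using (_≡_)
open import Relation.Nullary using (¬_)
open import Function.Definitions using (Injective)

-- Alphabets are finite: Σ = Fin n, Γ = Fin m.
-- A morphism Σ* → Γ* is determined by the images of letters.
Morphism : ℕ → ℕ → Set
Morphism n m = Fin n → List (Fin m)

ext : ∀ {n m} → Morphism n m → List (Fin n) → List (Fin m)
ext φ = concatMap φ

InjectiveMorphism : ∀ {n m} → Morphism n m → Set
InjectiveMorphism φ = Injective _≡_ _≡_ (ext φ)

NonEmpty : ∀ {A : Set} → List A → Set
NonEmpty xs = ¬ (xs ≡ [])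

module _ {n m : ℕ} (φ : Morphism n m) where

  ImageFactorization : List (Fin m) → Set
  ImageFactorization w = ∃[ cs ] (w ≡ ext φ cs)

  ProperSuffixOfImage : List (Fin m) → Set
  ProperSuffixOfImage x = ∃[ c ] ∃[ p ] (NonEmpty p × p ++ x ≡ φ c)

  ProperPrefixOfImage : List (Fin m) → Set
  ProperPrefixOfImage z = ∃[ c ] ∃[ s ] (NonEmpty s × z ++ s ≡ φ c)

  InterferedImageFactorization : List (Fin m) → Set
  InterferedImageFactorization w =
    ∃[ x ] ∃[ y ] ∃[ z ]
      ( w ≡ x ++ y ++ z
      × ProperSuffixOfImage x
      × ImageFactorization y
      × ProperPrefixOfImage z
      × NonEmpty (x ++ z) )

  IsFactor : List (Fin m) → List (Fin m) → Set
  IsFactor w v = ∃[ p ] ∃[ s ] (p ++ w ++ s ≡ v)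

  IsPrefix : List (Fin m) → List (Fin m) → Set
  IsPrefix w v = ∃[ s ] (w ++ s ≡ v)

  IsSuffix : List (Fin m) → List (Fin m) → Set
  IsSuffix w v = ∃[ p ] (p ++ w ≡ v)

  InnerImageFactor : List (Fin m) → Set
  InnerImageFactor w =
    ∃[ c ] ( IsFactor w (φ c) × ¬ (w ≡ φ c)
           × ¬ IsPrefix w (φ c) × ¬ IsSuffix w (φ c) )

  InterferenceFreeOn : (List (Fin n) → Set) → Set
  InterferenceFreeOn ℒ =
    ∀ u → ℒ u → NonEmpty u →
      ¬ InterferedImageFactorization (ext φ u) × ¬ InnerImageFactor (ext φ u)

  AllWords : List (Fin n) → Set
  AllWords _ = ⊤

  StronglyInterferenceFree : Set
  StronglyInterferenceFree = InterferenceFreeOn AllWords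

  Letters : List (Fin n) → Set
  Letters u = ∃[ c ] (u ≡ c ∷ [])

module Submission where

open import Defs
open import Function.Bundles using (_⇔_; mk⇔)
open import Data.Nat using (ℕ; _<_; s≤s)
open import Data.Nat.Properties using (<-irrefl; ≤-trans)
open import Data.Unit using (tt)
open import Data.Fin using (Fin)
open import Data.List using (List; []; _∷_; _++_; length)
open import Data.List.Properties
  using ( ++-assoc; ++-identityʳ; ++-conicalʳ; ∷-injectiveˡ; ∷-injectiveʳ
        ; length-++-≤ˡ; length-++-≤ʳ )
open import Data.Product using (∃-syntax; _×_; _,_; proj₁; proj₂)
open import Data.Sum using (_⊎_; inj₁; inj₂)
open import Data.Empty using (⊥-elim)
open import Relation.Binary.PropositionalEquality
  using (_≡_; _≢_; refl; sym; trans; cong; subst)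
open import Relation.Nullary using (¬_)

-- Interference-freeness on letters makes the images a prefix code and a suffix code,
-- and an image can occur inside another image only at its start. Now let
-- φ(c cs) = x y z be an interfered factorization. If x = ε, then φ(c cs) would be a
-- concatenation of images followed by a non-empty proper prefix of an image, which a
-- prefix code forbids. If x ≠ ε, x ends an image φ e; either φ c fits inside x and so
-- occurs strictly inside φ e, or φ c = x y′ z′ is itself interfered. An inner
-- occurrence of φ(c cs) in φ d would likewise put φ c inside φ d away from its start.

++-≡-++-split : ∀ {A : Set} (a b c d : List A) → a ++ b ≡ c ++ d →
  (∃[ t ] (a ++ t ≡ c × b ≡ t ++ d)) ⊎ (∃[ t ] (c ++ t ≡ a × d ≡ t ++ b))
++-≡-++-split []      b c       d eq = inj₁ (c , refl , eq)
++-≡-++-split (x ∷ a) b []      d eq = inj₂ (x ∷ a , refl , sym eq)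
++-≡-++-split (x ∷ a) b (y ∷ c) d eq
  with ∷-injectiveˡ eq | ++-≡-++-split a b c d (∷-injectiveʳ eq)
... | refl | inj₁ (t , a++t≡c , b≡t++d) = inj₁ (t , cong (x ∷_) a++t≡c , b≡t++d)
... | refl | inj₂ (t , c++t≡a , d≡t++b) = inj₂ (t , cong (x ∷_) c++t≡a , d≡t++b)

p++w++s≢w : ∀ {A : Set} (p w s : List A) → NonEmpty p → p ++ w ++ s ≢ w
p++w++s≢w []      w s p≢[] _  = p≢[] refl
p++w++s≢w (a ∷ p) w s _    eq =
  <-irrefl refl (subst (length w <_) (cong length eq)
    (s≤s (≤-trans (length-++-≤ˡ w) (length-++-≤ʳ (w ++ s) {p}))))

++-nonEmptyʳ : ∀ {A : Set} (r : List A) {s : List A} → NonEmpty s → NonEmpty (r ++ s)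
++-nonEmptyʳ r s≢[] r++s≡[] = s≢[] (++-conicalʳ r _ r++s≡[])

module _ {n m : ℕ} (φ : Morphism n m) where

  IsPrefixCode : Set
  IsPrefixCode = ∀ c d s → NonEmpty s → φ c ++ s ≢ φ d

  -- The y z part of an interfered image factorization.
  ImagesThenProperPrefix : List (Fin m) → Set
  ImagesThenProperPrefix w = ∃[ ys ] ∃[ z ] (w ≡ ext φ ys ++ z × ProperPrefixOfImage φ z)

  injective⇒images-nonEmpty : InjectiveMorphism φ → ∀ c → NonEmpty (φ c)
  injective⇒images-nonEmpty inj c φc≡[] with inj {c ∷ []} {[]} (cong (_++ []) φc≡[])
  ... | ()

  prefixCode⇒ext≢ext++properPrefix : IsPrefixCode → ∀ us ds z →
    NonEmpty z → ProperPrefixOfImage φ z → ext φ us ≢ ext φ ds ++ z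
  prefixCode⇒ext≢ext++properPrefix _ [] ds z z≢[] _ []≡ds++z =
    z≢[] (++-conicalʳ (ext φ ds) z (sym []≡ds++z))
  prefixCode⇒ext≢ext++properPrefix code (c ∷ us) [] z _ (f , s , s≢[] , z++s≡φf)
                                    φc++us≡z =
    code c f (ext φ us ++ s) (++-nonEmptyʳ (ext φ us) s≢[])
      (trans (sym (++-assoc (φ c) (ext φ us) s)) (trans (cong (_++ s) φc++us≡z) z++s≡φf))
  prefixCode⇒ext≢ext++properPrefix code (c ∷ us) (d ∷ ds) z z≢[] z-pp eq
    with ++-≡-++-split (φ c) (ext φ us) (φ d) (ext φ ds ++ z)
                       (trans eq (++-assoc (φ d) (ext φ ds) z))
  ... | inj₁ ([] , _ , us≡ds++z) =
    prefixCode⇒ext≢ext++properPrefix code us ds z z≢[] z-pp us≡ds++z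
  ... | inj₂ ([] , _ , ds++z≡us) =
    prefixCode⇒ext≢ext++properPrefix code us ds z z≢[] z-pp (sym ds++z≡us)
  ... | inj₁ (x ∷ t , φc++t≡φd , _) = code c d (x ∷ t) (λ ()) φc++t≡φd
  ... | inj₂ (x ∷ t , φd++t≡φc , _) = code d c (x ∷ t) (λ ()) φd++t≡φc

  imagesThenProperPrefix-prefixClosed : (∀ c → NonEmpty (φ c)) → ∀ t r ds z →
    t ++ r ≡ ext φ ds ++ z → ProperPrefixOfImage φ z → ImagesThenProperPrefix t
  imagesThenProperPrefix-prefixClosed _ t r [] z t++r≡z (f , s , s≢[] , z++s≡φf) =
    [] , t , refl , f , r ++ s , ++-nonEmptyʳ r s≢[] ,
      trans (sym (++-assoc t r s)) (trans (cong (_++ s) t++r≡z) z++s≡φf)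
  imagesThenProperPrefix-prefixClosed nonEmpty t r (d ∷ ds) z eq z-pp
    with ++-≡-++-split t r (φ d) (ext φ ds ++ z)
                       (trans eq (++-assoc (φ d) (ext φ ds) z))
  ... | inj₁ ([] , t++[]≡φd , _) =
    d ∷ [] , [] ,
      trans (sym (++-identityʳ t))
        (trans t++[]≡φd (sym (trans (++-identityʳ _) (++-identityʳ (φ d))))) ,
      d , φ d , nonEmpty d , refl
  ... | inj₁ (x ∷ u , t++u≡φd , _) = [] , t , refl , d , x ∷ u , (λ ()) , t++u≡φd
  ... | inj₂ (u , φd++u≡t , ds++z≡u++r)
    with imagesThenProperPrefix-prefixClosed nonEmpty u r ds z (sym ds++z≡u++r) z-pp
  ... | ys , z′ , u≡ys++z′ , z′-pp =
    d ∷ ys , z′ ,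
      trans (sym φd++u≡t)
        (trans (cong (φ d ++_) u≡ys++z′) (sym (++-assoc (φ d) (ext φ ys) z′))) ,
      z′-pp

module _ {n m : ℕ} (φ : Morphism n m)
         (images-nonEmpty : ∀ c → NonEmpty (φ c))
         (image-noInterference : ∀ c → ¬ InterferedImageFactorization φ (φ c))
         (image-notInner : ∀ c → ¬ InnerImageFactor φ (φ c)) where

  isPrefixCode : IsPrefixCode φ
  isPrefixCode c d s s≢[] φc++s≡φd = image-noInterference c
    ([] , [] , φ c , refl , (c , φ c , images-nonEmpty c , ++-identityʳ (φ c)) ,
     ([] , refl) , (d , s , s≢[] , φc++s≡φd) , images-nonEmpty c)

  image-notProperSuffix : ∀ p c d → NonEmpty p → p ++ φ c ≢ φ d
  image-notProperSuffix p c d p≢[] p++φc≡φd = image-noInterference c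
    (φ c , [] , [] , sym (++-identityʳ (φ c)) , (d , p , p≢[] , p++φc≡φd) ,
     ([] , refl) , (c , φ c , images-nonEmpty c , refl) ,
     λ φc++[]≡[] → images-nonEmpty c (trans (sym (++-identityʳ (φ c))) φc++[]≡[]))

  image-occurs-in-image-only-at-start : ∀ p c s d → NonEmpty p → p ++ φ c ++ s ≢ φ d
  image-occurs-in-image-only-at-start p c s d p≢[] eq =
    image-notInner c (d , (p , s , eq) , φc≢φd , not-prefix , not-suffix)
    where
      φc≢φd : φ c ≢ φ d
      φc≢φd φc≡φd = p++w++s≢w p (φ d) s p≢[] (subst (λ w → p ++ w ++ s ≡ φ d) φc≡φd eq)
      not-prefix : ¬ IsPrefix φ (φ c) (φ d)
      not-prefix ([]     , φc++[]≡φd) = φc≢φd (trans (sym (++-identityʳ (φ c))) φc++[]≡φd)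
      not-prefix (x ∷ s′ , φc++s′≡φd) = isPrefixCode c d (x ∷ s′) (λ ()) φc++s′≡φd
      not-suffix : ¬ IsSuffix φ (φ c) (φ d)
      not-suffix ([]     , φc≡φd)      = φc≢φd φc≡φd
      not-suffix (x ∷ p′ , p′++φc≡φd) = image-notProperSuffix (x ∷ p′) c d (λ ()) p′++φc≡φd

  ext-noInterference : ∀ c cs → ¬ InterferedImageFactorization φ (ext φ (c ∷ cs))
  ext-noInterference c cs ([] , _ , z , eq , _ , (ds , refl) , z-pp , z≢[]) =
    prefixCode⇒ext≢ext++properPrefix φ isPrefixCode (c ∷ cs) ds z z≢[] z-pp eq
  ext-noInterference c cs
    (x@(_ ∷ _) , _ , z , eq , x-ps@(e , p , p≢[] , p++x≡φe) , (ds , refl) , z-pp , _)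
    with ++-≡-++-split (φ c) (ext φ cs) x (ext φ ds ++ z) eq
  ... | inj₁ (t , φc++t≡x , _) =
    image-occurs-in-image-only-at-start p c t e p≢[] (trans (cong (p ++_) φc++t≡x) p++x≡φe)
  ... | inj₂ (t , x++t≡φc , ds++z≡t++cs)
    with imagesThenProperPrefix-prefixClosed φ images-nonEmpty t (ext φ cs) ds z
                                             (sym ds++z≡t++cs) z-pp
  ... | ys , z′ , t≡ys++z′ , z′-pp = image-noInterference c
    (x , ext φ ys , z′ , trans (sym x++t≡φc) (cong (x ++_) t≡ys++z′) ,
     x-ps , (ys , refl) , z′-pp , λ ())

  ext-notInner : ∀ c cs → ¬ InnerImageFactor φ (ext φ (c ∷ cs))
  ext-notInner c cs (d , ([] , s , w++s≡φd) , _ , not-prefix , _) = not-prefix (s , w++s≡φd)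
  ext-notInner c cs (d , (p@(_ ∷ _) , s , eq) , _) =
    image-occurs-in-image-only-at-start p c (ext φ cs ++ s) d (λ ())
      (trans (cong (p ++_) (sym (++-assoc (φ c) (ext φ cs) s))) eq)

  stronglyInterferenceFree : StronglyInterferenceFree φ
  stronglyInterferenceFree []       _ []≢[] = ⊥-elim ([]≢[] refl)
  stronglyInterferenceFree (c ∷ cs) _ _     = ext-noInterference c cs , ext-notInner c cs

lemma15 : ∀ {n m} (φ : Morphism n m) → InjectiveMorphism φ →
    (StronglyInterferenceFree φ ⇔ InterferenceFreeOn φ (Letters φ))
lemma15 φ inj = mk⇔ (λ strong u _ → strong u tt) onLetters⇒strong
  where
    onLetters⇒strong : InterferenceFreeOn φ (Letters φ) → StronglyInterferenceFree φ
    onLetters⇒strong onLetters =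
      stronglyInterferenceFree φ (injective⇒images-nonEmpty φ inj)
        (λ c → proj₁ (onLetter c)) (λ c → proj₂ (onLetter c))
      where
        onLetter : ∀ c → ¬ InterferedImageFactorization φ (φ c) × ¬ InnerImageFactor φ (φ c)
        onLetter c = subst (λ w → ¬ InterferedImageFactorization φ w × ¬ InnerImageFactor φ w)
          (++-identityʳ (φ c)) (onLetters (c ∷ []) (c , refl) (λ ()))
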